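{- $\mathrm{DISJ}\in\mathrm{HNN}$: the disjointness function $\mathrm{DISJ}:\{0,1\}^{2n}\to\{0,1\}$ has an HNN representation with $3n$ anchors.
   Context: $\mathrm{DISJ}(\mathbf{x},\mathbf{y})=\mathbf{1}[\langle\mathbf{x},\mathbf{y}\rangle=0]$ for $\mathbf{x},\mathbf{y}\in\{0,1\}^n$. Let $\Delta(\mathbf{u},\mathbf{v})=\|\mathbf{u}-\mathbf{v}\|_2^2$. An HNN representation of $f:\{0,1\}^{d}\to\{0,1\}$ is a pair of disjoint sets $P,N\subseteq\{0,1\}^{d}$ (anchors) such that $f(\mathbf{z})=1$ if some $\mathbf{p}\in P$ has $\Delta(\mathbf{z},\mathbf{p})<\Delta(\mathbf{z},\mathbf{q})$ for all $\mathbf{q}\in N$, and $f(\mathbf{z})=0$ if some $\mathbf{q}\in N$ has $\Delta(\mathbf{z},\mathbf{q})<\Delta(\mathbf{z},\mathbf{p})$ for all $\mathbf{p}\in P$; the number of anchors is $|P|+|N|$. $\mathrm{HNN}$ is the class of functions with HNN representations having polynomially many anchors. -}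

module Defs where

open import Data.Bool using (Bool; true; false; _∧_)
open import Data.Nat using (ℕ; zero; suc; _+_; _*_; _<_)
open import Data.Vec using (Vec; []; _∷_; _++_; splitAt)
open import Data.List using (List; length)
open import Data.List.Membership.Propositional using (_∈_)
open import Data.List.Relation.Unary.Unique.Propositional using (Unique)
open import Data.Product using (Σ; _×_; _,_; ∃; ∃-syntax)
open import Relation.Binary.PropositionalEquality using (_≡_)
open import Relation.Nullary using (¬_)

Cube : ℕ → Set
Cube d = Vec Bool d

bit : Bool → ℕ
bit true  = 1
bit false = 0

sqdiff : Bool → Bool → ℕ
sqdiff true  true  = 0
sqdiff false false = 0
sqdiff true  false = 1
sqdiff false true  = 1

Δ : ∀ {d} → Cube d → Cube d → ℕ
Δ []       []       = 0
Δ (a ∷ u)  (b ∷ v)  = sqdiff a b + Δ u v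

inner : ∀ {n} → Cube n → Cube n → ℕ
inner []      []      = 0
inner (a ∷ x) (b ∷ y) = bit a * bit b + inner x y

DISJ : ∀ n → Cube (n + n) → Bool
DISJ n z with splitAt n z
... | x , y , _ = isZero (inner x y)
  where
  isZero : ℕ → Bool
  isZero zero    = true
  isZero (suc _) = false

-- An HNN representation of f with anchor sets P, N (given as duplicate-free
-- lists, i.e. finite sets), required disjoint.
record IsHNNRep {d : ℕ} (f : Cube d → Bool) (P N : List (Cube d)) : Set where
  field
    P-set    : Unique P
    N-set    : Unique N
    disjoint : ∀ {u} → u ∈ P → ¬ (u ∈ N)
    pos      : ∀ z → f z ≡ true →
               ∃[ p ] (p ∈ P × (∀ q → q ∈ N → Δ z p < Δ z q))
    neg      : ∀ z → f z ≡ false →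
               ∃[ q ] (q ∈ N × (∀ p → p ∈ P → Δ z q < Δ z p))

HasHNNRep : ∀ {d} → (Cube d → Bool) → ℕ → Set
HasHNNRep {d} f k =
  Σ (List (Cube d)) λ P → Σ (List (Cube d)) λ N →
    IsHNNRep f P N × (length P + length N ≡ k)

-- The 2n unit vectors of {0,1}^{2n} are positive anchors and the n vectors
-- eᵢ ++ eᵢ are negative anchors. Since Δ(z,a) = |z| + |a| − 2⟨z,a⟩, a unit
-- vector beats a doubled one iff it has at least the same inner product with z.
-- If x and y are disjoint, every eᵢ ++ eᵢ meets z = (x,y) in at most one
-- coordinate, while a unit vector at a 1 of z (any, if z = 0) meets it in one;
-- if xᵢ = yᵢ = 1, then eᵢ ++ eᵢ meets z twice and no unit vector does.
module Submission where

open import Defs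
open import Data.Bool using (true; false)
open import Data.Fin using (Fin; zero; suc)
open import Data.List using (List; tabulate; length)
open import Data.List.Membership.Propositional using (_∈_)
open import Data.List.Membership.Propositional.Properties using (∈-tabulate⁺; ∈-tabulate⁻)
open import Data.List.Properties using (length-tabulate)
open import Data.List.Relation.Unary.Unique.Propositional using (Unique)
open import Data.List.Relation.Unary.Unique.Propositional.Properties using (tabulate⁺)
open import Data.Nat using (ℕ; zero; suc; _+_; _*_; _≤_; _<_; z≤n; s≤s)
open import Data.Nat.Properties
open import Data.Nat.Tactic.RingSolver using (solve-∀)
open import Algebra.Properties.CommutativeSemigroup +-commutativeSemigroup
  using (interchange; x∙yz≈xz∙y; xy∙z≈xz∙y)
open import Data.Product using (_×_; _,_; ∃-syntax)
open import Data.Vec using ([]; _∷_; _++_; replicate; lookup; splitAt; tail)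
open import Data.Vec.Properties using (++-injectiveˡ)
open import Relation.Binary.PropositionalEquality
open import Relation.Nullary using (¬_)

zeros : ∀ n → Cube n
zeros n = replicate n false

unit : ∀ {n} → Fin n → Cube n
unit {suc n} zero    = true ∷ zeros n
unit {suc n} (suc i) = false ∷ unit i

count : ∀ {n} → Cube n → ℕ
count []      = 0
count (a ∷ v) = bit a + count v

unit-injective : ∀ {n} {i j : Fin n} → unit i ≡ unit j → i ≡ j
unit-injective {i = zero}  {zero}  _  = refl
unit-injective {i = suc i} {suc j} eq = cong suc (unit-injective (cong tail eq))

bit≤1 : ∀ a → bit a ≤ 1
bit≤1 true  = s≤s z≤n
bit≤1 false = z≤n

count-zeros : ∀ n → count (zeros n) ≡ 0
count-zeros zero    = refl
count-zeros (suc n) = count-zeros n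

count-unit : ∀ {n} (i : Fin n) → count (unit i) ≡ 1
count-unit {suc n} zero = cong suc (count-zeros n)
count-unit (suc i)      = count-unit i

count-++ : ∀ {m n} (u : Cube m) (v : Cube n) → count (u ++ v) ≡ count u + count v
count-++ []      v = refl
count-++ (a ∷ u) v = trans (cong (bit a +_) (count-++ u v)) (sym (+-assoc (bit a) _ _))

inner-zerosʳ : ∀ {n} (x : Cube n) → inner x (zeros n) ≡ 0
inner-zerosʳ {zero}  []      = refl
inner-zerosʳ {suc n} (a ∷ x) = trans (cong (_+ inner x (zeros n)) (*-zeroʳ (bit a))) (inner-zerosʳ x)

inner-unitʳ : ∀ {n} (x : Cube n) (i : Fin n) → inner x (unit i) ≡ bit (lookup x i)
inner-unitʳ (a ∷ x) zero    =
  trans (cong₂ _+_ (*-identityʳ (bit a)) (inner-zerosʳ x)) (+-identityʳ (bit a))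
inner-unitʳ (a ∷ x) (suc i) = cong₂ _+_ (*-zeroʳ (bit a)) (inner-unitʳ x i)

inner-++ : ∀ {m n} (x u : Cube m) (y v : Cube n) → inner (x ++ y) (u ++ v) ≡ inner x u + inner y v
inner-++ []      []      y v = refl
inner-++ (a ∷ x) (b ∷ u) y v =
  trans (cong (bit a * bit b +_) (inner-++ x u y v)) (sym (+-assoc (bit a * bit b) _ _))

inner≤count : ∀ {n} (u v : Cube n) → inner u v ≤ count u
inner≤count []      []      = z≤n
inner≤count (a ∷ u) (b ∷ v) = +-mono-≤ (bit-product a b) (inner≤count u v)
  where
  bit-product : ∀ a b → bit a * bit b ≤ bit a
  bit-product true  true  = ≤-refl
  bit-product true  false = z≤n
  bit-product false b     = z≤n

sqdiff+2*product : ∀ a b → sqdiff a b + 2 * (bit a * bit b) ≡ bit a + bit b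
sqdiff+2*product true  true  = refl
sqdiff+2*product true  false = refl
sqdiff+2*product false true  = refl
sqdiff+2*product false false = refl

Δ+2*inner : ∀ {n} (u v : Cube n) → Δ u v + 2 * inner u v ≡ count u + count v
Δ+2*inner []      []      = refl
Δ+2*inner (a ∷ u) (b ∷ v) = begin
  (sqdiff a b + Δ u v) + 2 * (bit a * bit b + inner u v)
    ≡⟨ regroup (sqdiff a b) (Δ u v) (bit a * bit b) (inner u v) ⟩
  (sqdiff a b + 2 * (bit a * bit b)) + (Δ u v + 2 * inner u v)
    ≡⟨ cong₂ _+_ (sqdiff+2*product a b) (Δ+2*inner u v) ⟩
  (bit a + bit b) + (count u + count v)
    ≡⟨ interchange (bit a) (bit b) (count u) (count v) ⟩
  (bit a + count u) + (bit b + count v) ∎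
  where
  open ≡-Reasoning
  regroup : ∀ s d p i → (s + d) + 2 * (p + i) ≡ (s + 2 * p) + (d + 2 * i)
  regroup = solve-∀

Δ<Δ-by-inner : ∀ {n} (z a b : Cube n) →
               count a + 2 * inner z b < count b + 2 * inner z a → Δ z a < Δ z b
Δ<Δ-by-inner z a b h = +-cancelʳ-< (count a + 2 * inner z b) (Δ z a) (Δ z b) (begin-strict
  Δ z a + (count a + 2 * inner z b)       <⟨ +-monoʳ-< (Δ z a) h ⟩
  Δ z a + (count b + 2 * inner z a)       ≡⟨ x∙yz≈xz∙y (Δ z a) (count b) (2 * inner z a) ⟩
  (Δ z a + 2 * inner z a) + count b       ≡⟨ cong (_+ count b) (Δ+2*inner z a) ⟩
  (count z + count a) + count b           ≡⟨ xy∙z≈xz∙y (count z) (count a) (count b) ⟩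
  (count z + count b) + count a           ≡⟨ cong (_+ count a) (Δ+2*inner z b) ⟨
  (Δ z b + 2 * inner z b) + count a       ≡⟨ x∙yz≈xz∙y (Δ z b) (count a) (2 * inner z b) ⟨
  Δ z b + (count a + 2 * inner z b)       ∎)
  where open ≤-Reasoning

unit-closer : ∀ {n} (z : Cube n) {a b : Cube n} → count a ≡ 1 → count b ≡ 2 →
              inner z b ≤ inner z a → Δ z a < Δ z b
unit-closer z {a} {b} ∣a∣≡1 ∣b∣≡2 h = Δ<Δ-by-inner z a b
  (subst₂ (λ ∣a∣ ∣b∣ → ∣a∣ + 2 * inner z b < ∣b∣ + 2 * inner z a)
          (sym ∣a∣≡1) (sym ∣b∣≡2) (s≤s (s≤s (*-monoʳ-≤ 2 h))))

pair-closer : ∀ {n} (z : Cube n) {a b : Cube n} → count a ≡ 1 → count b ≡ 2 →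
              inner z a < inner z b → Δ z b < Δ z a
pair-closer z {a} {b} ∣a∣≡1 ∣b∣≡2 h = Δ<Δ-by-inner z b a
  (subst₂ (λ ∣b∣ ∣a∣ → ∣b∣ + 2 * inner z a < ∣a∣ + 2 * inner z b)
          (sym ∣b∣≡2) (sym ∣a∣≡1) (s≤s (subst (_≤ 2 * inner z b) (*-suc 2 (inner z a)) (*-monoʳ-≤ 2 h))))

inner≡0⇒bit+bit≤1 : ∀ {n} (x y : Cube n) → inner x y ≡ 0 →
                    ∀ i → bit (lookup x i) + bit (lookup y i) ≤ 1
inner≡0⇒bit+bit≤1 (true  ∷ x) (true  ∷ y) ()
inner≡0⇒bit+bit≤1 (true  ∷ x) (false ∷ y) h zero    = ≤-refl
inner≡0⇒bit+bit≤1 (false ∷ x) (b     ∷ y) h zero    = bit≤1 b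
inner≡0⇒bit+bit≤1 (true  ∷ x) (false ∷ y) h (suc i) = inner≡0⇒bit+bit≤1 x y h i
inner≡0⇒bit+bit≤1 (false ∷ x) (b     ∷ y) h (suc i) = inner≡0⇒bit+bit≤1 x y h i

inner≡suc⇒common-one : ∀ {n k} (x y : Cube n) → inner x y ≡ suc k →
                       ∃[ i ] (lookup x i ≡ true × lookup y i ≡ true)
inner≡suc⇒common-one []          []          ()
inner≡suc⇒common-one (true  ∷ x) (true  ∷ y) h = zero , refl , refl
inner≡suc⇒common-one (true  ∷ x) (false ∷ y) h with inner≡suc⇒common-one x y h
... | i , xᵢ , yᵢ = suc i , xᵢ , yᵢ
inner≡suc⇒common-one (false ∷ x) (b     ∷ y) h with inner≡suc⇒common-one x y h
... | i , xᵢ , yᵢ = suc i , xᵢ , yᵢ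

count≡suc⇒one : ∀ {n k} (z : Cube n) → count z ≡ suc k → ∃[ i ] lookup z i ≡ true
count≡suc⇒one []          ()
count≡suc⇒one (true  ∷ z) h = zero , refl
count≡suc⇒one (false ∷ z) h with count≡suc⇒one z h
... | i , zᵢ = suc i , zᵢ

doubled : ∀ {n} → Fin n → Cube (n + n)
doubled i = unit i ++ unit i

units : ∀ d → List (Cube d)
units d = tabulate unit

doubledUnits : ∀ n → List (Cube (n + n))
doubledUnits n = tabulate (doubled {n})

count-doubled : ∀ {n} (i : Fin n) → count (doubled i) ≡ 2
count-doubled i = trans (count-++ (unit i) (unit i)) (cong₂ _+_ (count-unit i) (count-unit i))

inner-doubledʳ : ∀ {n} (x y : Cube n) (i : Fin n) →
                 inner (x ++ y) (doubled i) ≡ bit (lookup x i) + bit (lookup y i)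
inner-doubledʳ x y i = trans (inner-++ x (unit i) y (unit i)) (cong₂ _+_ (inner-unitʳ x i) (inner-unitʳ y i))

units-disjoint-doubledUnits : ∀ {n} {u : Cube (n + n)} → u ∈ units (n + n) → ¬ u ∈ doubledUnits n
units-disjoint-doubledUnits u∈P u∈N with ∈-tabulate⁻ u∈P | ∈-tabulate⁻ u∈N
... | k , refl | i , eq with trans (sym (count-unit k)) (trans (cong count eq) (count-doubled i))
... | ()

doubledUnits-unique : ∀ n → Unique (doubledUnits n)
doubledUnits-unique n = tabulate⁺ (λ eq → unit-injective (++-injectiveˡ _ _ eq))

anchor-count : ∀ n → length (units (n + n)) + length (doubledUnits n) ≡ 3 * n
anchor-count n = begin
  length (units (n + n)) + length (doubledUnits n)
    ≡⟨ cong₂ _+_ (length-tabulate (unit {n + n})) (length-tabulate (doubled {n})) ⟩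
  (n + n) + n
    ≡⟨ n+n+n≡3*n n ⟩
  3 * n ∎
  where
  open ≡-Reasoning
  n+n+n≡3*n : ∀ n → (n + n) + n ≡ 3 * n
  n+n+n≡3*n = solve-∀

unit-beats-doubledUnits : ∀ {n} (x y : Cube n) (k : Fin (n + n)) →
                          (∀ i → bit (lookup x i) + bit (lookup y i) ≤ bit (lookup (x ++ y) k)) →
                          ∀ q → q ∈ doubledUnits n → Δ (x ++ y) (unit k) < Δ (x ++ y) q
unit-beats-doubledUnits x y k h q q∈N with ∈-tabulate⁻ q∈N
... | i , refl = unit-closer (x ++ y) (count-unit k) (count-doubled i)
  (subst₂ _≤_ (sym (inner-doubledʳ x y i)) (sym (inner-unitʳ (x ++ y) k)) (h i))

units-closer : ∀ {n} (x y : Cube n) → Fin (n + n) → inner x y ≡ 0 →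
               ∃[ p ] (p ∈ units (n + n) × (∀ q → q ∈ doubledUnits n → Δ (x ++ y) p < Δ (x ++ y) q))
units-closer x y k₀ x·y≡0 with count (x ++ y) in ∣z∣
... | zero = unit k₀ , ∈-tabulate⁺ k₀ , unit-beats-doubledUnits x y k₀ (λ i → ≤-trans (begin
  bit (lookup x i) + bit (lookup y i) ≡⟨ inner-doubledʳ x y i ⟨
  inner (x ++ y) (doubled i)          ≤⟨ inner≤count (x ++ y) (doubled i) ⟩
  count (x ++ y)                      ≡⟨ ∣z∣ ⟩
  0                                   ∎) z≤n)
  where open ≤-Reasoning
... | suc _ with count≡suc⇒one (x ++ y) ∣z∣
... | k , zₖ = unit k , ∈-tabulate⁺ k , unit-beats-doubledUnits x y k
  (λ i → subst (λ b → bit (lookup x i) + bit (lookup y i) ≤ bit b) (sym zₖ) (inner≡0⇒bit+bit≤1 x y x·y≡0 i))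

doubledUnits-closer : ∀ {n k} (x y : Cube n) → inner x y ≡ suc k →
                      ∃[ q ] (q ∈ doubledUnits n × (∀ p → p ∈ units (n + n) → Δ (x ++ y) q < Δ (x ++ y) p))
doubledUnits-closer x y x·y≡suc with inner≡suc⇒common-one x y x·y≡suc
... | i , xᵢ , yᵢ = doubled i , ∈-tabulate⁺ i , beats
  where
  beats : ∀ p → p ∈ units _ → Δ (x ++ y) (doubled i) < Δ (x ++ y) p
  beats p p∈P with ∈-tabulate⁻ p∈P
  ... | k , refl = pair-closer (x ++ y) (count-unit k) (count-doubled i) (begin-strict
    inner (x ++ y) (unit k)             ≡⟨ inner-unitʳ (x ++ y) k ⟩
    bit (lookup (x ++ y) k)             ≤⟨ bit≤1 (lookup (x ++ y) k) ⟩
    1                                   <⟨ n<1+n 1 ⟩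
    2                                   ≡⟨ cong₂ (λ a b → bit a + bit b) xᵢ yᵢ ⟨
    bit (lookup x i) + bit (lookup y i) ≡⟨ inner-doubledʳ x y i ⟨
    inner (x ++ y) (doubled i)          ∎)
    where open ≤-Reasoning

DISJ-isHNNRep : ∀ n → Fin (n + n) → IsHNNRep (DISJ n) (units (n + n)) (doubledUnits n)
DISJ-isHNNRep n k₀ = record
  { P-set    = tabulate⁺ unit-injective
  ; N-set    = doubledUnits-unique n
  ; disjoint = units-disjoint-doubledUnits
  ; pos      = pos
  ; neg      = neg
  }
  where
  pos : ∀ z → DISJ n z ≡ true →
        ∃[ p ] (p ∈ units (n + n) × (∀ q → q ∈ doubledUnits n → Δ z p < Δ z q))
  pos z h with splitAt n z
  ... | x , y , refl with inner x y in x·y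
  ... | zero = units-closer x y k₀ x·y
  pos z () | x , y , refl | suc _

  neg : ∀ z → DISJ n z ≡ false →
        ∃[ q ] (q ∈ doubledUnits n × (∀ p → p ∈ units (n + n) → Δ z q < Δ z p))
  neg z h with splitAt n z
  ... | x , y , refl with inner x y in x·y
  ... | suc _ = doubledUnits-closer x y x·y
  neg z () | x , y , refl | zero

theorem10 : ∀ n → 1 ≤ n → HasHNNRep (DISJ n) (3 * n)
theorem10 n@(suc _) _ = units (n + n) , doubledUnits n , DISJ-isHNNRep n zero , anchor-count n
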